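{- Let $\mathbf{A}$ be a Stone distributive nearlattice and let $a,b\in A$ be such that the meet $a\wedge b$ exists in $A$. Then $(a\wedge b)^{\top\top}=a^{\top\top}\veebar b^{\top\top}$.
   Context: A distributive nearlattice is a join-semilattice $\langle A,\vee,1\rangle$ with greatest element $1$ in which every principal filter $[a)=\{x\in A\colon a\le x\}$ is a bounded distributive lattice. A filter of $A$ is a subset containing $1$, upward closed, and closed under those binary meets that exist; for filters $F,G$, $F\veebar G$ is the smallest filter containing $F\cup G$. For $a\in A$, $a^{\top}=\{x\in A\colon x\vee a=1\}$ and $a^{\top\top}=\{y\in A\colon y\vee x=1\text{ for all }x\in a^{\top}\}$. $\mathbf{A}$ is Stone if $a^{\top}\veebar a^{\top\top}=A$ for every $a\in A$. -}

module Defs where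

open import Level using (Level; _⊔_) renaming (suc to lsuc)
open import Data.Product using (Σ; _×_)
open import Data.Unit.Polymorphic renaming (⊤ to Unit)
open import Relation.Binary.PropositionalEquality using (_≡_)

Subset : ∀ {c} → Set c → Set (lsuc c)
Subset {c} A = A → Set c

record DistributiveNearlattice (c : Level) : Set (lsuc c) where
  infixr 6 _∨_
  infix 4 _≤_
  field
    Carrier : Set c
    _∨_     : Carrier → Carrier → Carrier
    𝟏       : Carrier

  _≤_ : Carrier → Carrier → Set c
  x ≤ y = x ∨ y ≡ y

  IsMeetIn : Subset Carrier → Carrier → Carrier → Carrier → Set c
  IsMeetIn P x y m =
    P m × m ≤ x × m ≤ y × (∀ z → P z → z ≤ x → z ≤ y → z ≤ m)

  principal : Carrier → Subset Carrier
  principal a x = a ≤ x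

  field
    ∨-assoc : ∀ x y z → (x ∨ y) ∨ z ≡ x ∨ (y ∨ z)
    ∨-comm  : ∀ x y → x ∨ y ≡ y ∨ x
    ∨-idem  : ∀ x → x ∨ x ≡ x
    ∨-top   : ∀ x → x ∨ 𝟏 ≡ 𝟏
    -- each principal filter [a) is a lattice: binary meets exist in [a)
    -- (joins in [a) are given by ∨, bounds are a and 1)
    meet-in-filter : ∀ a x y → a ≤ x → a ≤ y → Σ Carrier (IsMeetIn (principal a) x y)
    distrib-in-filter : ∀ a x y z m n k →
      a ≤ x → a ≤ y → a ≤ z →
      IsMeetIn (principal a) x (y ∨ z) m → IsMeetIn (principal a) x y n → IsMeetIn (principal a) x z k →
      m ≡ n ∨ k

  Full : Subset Carrier
  Full _ = Unit

  IsMeet : Carrier → Carrier → Carrier → Set c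
  IsMeet = IsMeetIn Full

  _⊆_ : Subset Carrier → Subset Carrier → Set c
  F ⊆ G = ∀ x → F x → G x

  record IsFilter (F : Subset Carrier) : Set c where
    field
      has-𝟏    : F 𝟏
      up-closed : ∀ x y → x ≤ y → F x → F y
      meet-closed : ∀ x y m → F x → F y → IsMeet x y m → F m

  IsFilterJoin : Subset Carrier → Subset Carrier → Subset Carrier → Set (lsuc c)
  IsFilterJoin F G X =
    IsFilter X × F ⊆ X × G ⊆ X ×
    (∀ H → IsFilter H → F ⊆ H → G ⊆ H → X ⊆ H)

  _⊤ : Carrier → Subset Carrier
  (a ⊤) x = x ∨ a ≡ 𝟏

  _⊤⊤ : Carrier → Subset Carrier
  (a ⊤⊤) y = ∀ x → (a ⊤) x → y ∨ x ≡ 𝟏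

  IsStone : Set (lsuc c)
  IsStone = ∀ a → IsFilterJoin (a ⊤) (a ⊤⊤) Full

-- Distributivity of the principal filter [x ∧ y) shows that joining with a fixed
-- element preserves existing meets: (x ∧ y) ∨ z = (x ∨ z) ∧ (y ∨ z). Hence every
-- a⊤⊤ is a filter, and for t ∈ a⊤, s ∈ b⊤ the element s ∨ t lies in (a ∧ b)⊤, so
-- y ∈ (a ∧ b)⊤⊤ gives s ∨ t ∨ y = 1. Conversely, for a filter H containing a⊤⊤
-- and b⊤⊤ the sets {z : z ∨ c ∈ H} are filters too; the Stone property of b
-- (with c = t ∨ y) puts t ∨ y in H for every t ∈ a⊤, and then that of a (with
-- c = y) puts y in H.
module Submission where

open import Defs
open import Level using (Level)
open import Data.Product using (_,_)
open import Data.Unit.Polymorphic using (tt)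
open import Relation.Binary.PropositionalEquality
  using (_≡_; refl; sym; trans; cong; subst; isEquivalence; module ≡-Reasoning)
open import Relation.Binary.Lattice using (JoinSemilattice)
import Relation.Binary.Lattice.Properties.JoinSemilattice as JoinSemilatticeProperties
import Relation.Binary.Reasoning.PartialOrder as PosetReasoning

module DistributiveNearlatticeProperties {c : Level} (𝐀 : DistributiveNearlattice c) where
  open DistributiveNearlattice 𝐀

  ≤-refl : ∀ {x} → x ≤ x
  ≤-refl {x} = ∨-idem x

  ≤-trans : ∀ {x y z} → x ≤ y → y ≤ z → x ≤ z
  ≤-trans {x} {y} {z} x≤y y≤z = begin
    x ∨ z        ≡⟨ cong (x ∨_) (sym y≤z) ⟩
    x ∨ (y ∨ z)  ≡⟨ sym (∨-assoc x y z) ⟩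
    (x ∨ y) ∨ z  ≡⟨ cong (_∨ z) x≤y ⟩
    y ∨ z        ≡⟨ y≤z ⟩
    z            ∎
    where open ≡-Reasoning

  x≤x∨y : ∀ x y → x ≤ x ∨ y
  x≤x∨y x y = trans (sym (∨-assoc x x y)) (cong (_∨ y) (∨-idem x))

  y≤x∨y : ∀ x y → y ≤ x ∨ y
  y≤x∨y x y = subst (y ≤_) (∨-comm y x) (x≤x∨y y x)

  ∨-least : ∀ {x y z} → x ≤ z → y ≤ z → x ∨ y ≤ z
  ∨-least {x} {y} {z} x≤z y≤z = trans (∨-assoc x y z) (trans (cong (x ∨_) y≤z) x≤z)

  joinSemilattice : JoinSemilattice c c c
  joinSemilattice = record
    { _≤_ = _≤_
    ; _∨_ = _∨_
    ; isJoinSemilattice = record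
      { isPartialOrder = record
        { isPreorder = record
          { isEquivalence = isEquivalence
          ; reflexive     = λ { refl → ≤-refl }
          ; trans         = ≤-trans
          }
        ; antisym = λ {x} {y} x≤y y≤x → trans (sym y≤x) (trans (∨-comm y x) x≤y)
        }
      ; supremum = λ x y → x≤x∨y x y , y≤x∨y x y , λ _ → ∨-least
      }
    }

  open JoinSemilatticeProperties joinSemilattice using (∨-monotonic)
  open PosetReasoning (JoinSemilattice.poset joinSemilattice)

  ≡𝟏-upward : ∀ {x y} → x ≤ y → x ≡ 𝟏 → y ≡ 𝟏
  ≡𝟏-upward {y = y} x≤y refl = trans (sym x≤y) (trans (∨-comm 𝟏 y) (∨-top y))

  IsMeetIn-sym : ∀ {P x y m} → IsMeetIn P x y m → IsMeetIn P y x m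
  IsMeetIn-sym (m∈P , m≤x , m≤y , greatest) =
    m∈P , m≤y , m≤x , λ z z∈P z≤y z≤x → greatest z z∈P z≤x z≤y

  IsMeet⇒IsMeetIn-principal : ∀ {x y m} → IsMeet x y m → IsMeetIn (principal m) x y m
  IsMeet⇒IsMeetIn-principal (_ , m≤x , m≤y , greatest) =
    ≤-refl , m≤x , m≤y , λ z _ → greatest z tt

  IsMeetIn-principal-≤ : ∀ {a x y} → a ≤ x → x ≤ y → IsMeetIn (principal a) y x x
  IsMeetIn-principal-≤ a≤x x≤y = a≤x , x≤y , ≤-refl , λ _ _ _ z≤x → z≤x

  -- Inside [x ∧ y), distributivity gives (y ∨ s) ∧ (x ∨ s) = ((y ∨ s) ∧ x) ∨ s
  -- and (y ∨ s) ∧ x = (x ∧ y) ∨ (x ∧ s), both of which lie below s.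
  ∨-meet-≤ : ∀ {x y m s r n k} → IsMeet x y m → m ≤ s →
             IsMeetIn (principal m) (y ∨ s) (x ∨ s) r →
             IsMeetIn (principal m) x (y ∨ s) n →
             IsMeetIn (principal m) x s k → r ≤ s
  ∨-meet-≤ {x} {y} {m} {s} {r} {n} {k}
           x∧y≡m@(_ , m≤x , m≤y , _) m≤s r-meet n-meet k-meet@(_ , _ , k≤s , _) =
    begin
      r            ≡⟨ r≡n∨s ⟩
      n ∨ s        ≡⟨ cong (_∨ s) n≡m∨k ⟩
      (m ∨ k) ∨ s  ≤⟨ ∨-least (∨-least m≤s k≤s) ≤-refl ⟩
      s            ∎
    where
    m≤y∨s = ≤-trans m≤y (x≤x∨y y s)
    r≡n∨s : r ≡ n ∨ s
    r≡n∨s = distrib-in-filter m (y ∨ s) x s r n s m≤y∨s m≤x m≤s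
      r-meet (IsMeetIn-sym n-meet) (IsMeetIn-principal-≤ m≤s (y≤x∨y y s))
    n≡m∨k : n ≡ m ∨ k
    n≡m∨k = distrib-in-filter m x y s n m k m≤x m≤y m≤s
      n-meet (IsMeet⇒IsMeetIn-principal x∧y≡m) k-meet

  ∨-meet-principal : ∀ {x y m s} → IsMeet x y m → m ≤ s →
                     IsMeetIn (principal m) (y ∨ s) (x ∨ s) s
  ∨-meet-principal {x} {y} {m} {s} x∧y≡m@(_ , m≤x , m≤y , _) m≤s
    with meet-in-filter m (y ∨ s) (x ∨ s) (≤-trans m≤y (x≤x∨y y s)) (≤-trans m≤x (x≤x∨y x s))
       | meet-in-filter m x (y ∨ s) m≤x (≤-trans m≤y (x≤x∨y y s))
       | meet-in-filter m x s m≤x m≤s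
  ... | _ , r-meet@(_ , _ , _ , r-greatest) | _ , n-meet | _ , k-meet =
    m≤s , y≤x∨y y s , y≤x∨y x s ,
    λ z m≤z z≤y∨s z≤x∨s →
      ≤-trans (r-greatest z m≤z z≤y∨s z≤x∨s) (∨-meet-≤ x∧y≡m m≤s r-meet n-meet k-meet)

  ∨-preserves-meet : ∀ {x y m} z → IsMeet x y m → IsMeet (x ∨ z) (y ∨ z) (m ∨ z)
  ∨-preserves-meet {x} {y} {m} z x∧y≡m@(_ , m≤x , m≤y , _) =
    tt , ∨-monotonic m≤x ≤-refl , ∨-monotonic m≤y ≤-refl , greatest
    where
    s = m ∨ z
    greatest : ∀ w → Full w → w ≤ x ∨ z → w ≤ y ∨ z → w ≤ s
    greatest w _ w≤x∨z w≤y∨z = begin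
      w      ≤⟨ x≤x∨y w m ⟩
      w ∨ m  ≤⟨ s-greatest (w ∨ m) (y≤x∨y w m) (lift w≤y∨z m≤y) (lift w≤x∨z m≤x) ⟩
      s      ∎
      where
      s-greatest = let (_ , _ , _ , g) = ∨-meet-principal x∧y≡m (x≤x∨y m z) in g
      lift : ∀ {u} → w ≤ u ∨ z → m ≤ u → w ∨ m ≤ u ∨ s
      lift {u} w≤u∨z m≤u =
        ∨-least (≤-trans w≤u∨z (∨-monotonic (≤-refl {u}) (y≤x∨y m z))) (≤-trans m≤u (x≤x∨y u s))

  meet-≡𝟏 : ∀ {x y m} → IsMeet x y m → x ≡ 𝟏 → y ≡ 𝟏 → m ≡ 𝟏
  meet-≡𝟏 (_ , _ , _ , greatest) refl refl = ≡𝟏-upward (greatest 𝟏 tt ≤-refl ≤-refl) refl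

  ⊤-meet : ∀ {x y m z} → IsMeet x y m → (x ⊤) z → (y ⊤) z → (m ⊤) z
  ⊤-meet {x} {y} {m} {z} x∧y≡m z∨x≡𝟏 z∨y≡𝟏 =
    trans (∨-comm z m)
      (meet-≡𝟏 (∨-preserves-meet z x∧y≡m) (trans (∨-comm x z) z∨x≡𝟏) (trans (∨-comm y z) z∨y≡𝟏))

  ⊤⊤-isFilter : ∀ a → IsFilter (a ⊤⊤)
  ⊤⊤-isFilter a = record
    { has-𝟏       = λ x _ → ≡𝟏-upward (x≤x∨y 𝟏 x) refl
    ; up-closed   = λ x y x≤y x∈a⊤⊤ t t∈a⊤ → ≡𝟏-upward (∨-monotonic x≤y ≤-refl) (x∈a⊤⊤ t t∈a⊤)
    ; meet-closed = λ x y m x∈a⊤⊤ y∈a⊤⊤ x∧y≡m t t∈a⊤ →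
        meet-≡𝟏 (∨-preserves-meet t x∧y≡m) (x∈a⊤⊤ t t∈a⊤) (y∈a⊤⊤ t t∈a⊤)
    }

  ⊤⊤-antitone : ∀ {x y} → x ≤ y → (y ⊤⊤) ⊆ (x ⊤⊤)
  ⊤⊤-antitone x≤y u u∈y⊤⊤ t t∨x≡𝟏 = u∈y⊤⊤ t (≡𝟏-upward (∨-monotonic ≤-refl x≤y) t∨x≡𝟏)

  ∨-preimage : Subset Carrier → Carrier → Subset Carrier
  ∨-preimage H c z = H (z ∨ c)

  ∨-preimage-isFilter : ∀ {H} c → IsFilter H → IsFilter (∨-preimage H c)
  ∨-preimage-isFilter {H} c H-filter = record
    { has-𝟏       = subst H (sym (≡𝟏-upward (x≤x∨y 𝟏 c) refl)) has-𝟏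
    ; up-closed   = λ x y x≤y → up-closed (x ∨ c) (y ∨ c) (∨-monotonic x≤y ≤-refl)
    ; meet-closed = λ x y m x∨c∈H y∨c∈H x∧y≡m →
        meet-closed (x ∨ c) (y ∨ c) (m ∨ c) x∨c∈H y∨c∈H (∨-preserves-meet c x∧y≡m)
    }
    where open IsFilter H-filter

  stone-∨-preimage-∈ : IsStone → ∀ {H} a c → IsFilter H →
                       (a ⊤) ⊆ ∨-preimage H c → (a ⊤⊤) ⊆ H → H c
  stone-∨-preimage-∈ stone {H} a c H-filter a⊤⊆ a⊤⊤⊆H =
    subst H (∨-idem c)
      (least (∨-preimage H c) (∨-preimage-isFilter c H-filter) a⊤⊆ a⊤⊤⊆ c tt)
    where
    least = let (_ , _ , _ , l) = stone a in l
    a⊤⊤⊆ : (a ⊤⊤) ⊆ ∨-preimage H c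
    a⊤⊤⊆ u u∈a⊤⊤ = IsFilter.up-closed H-filter u (u ∨ c) (x≤x∨y u c) (a⊤⊤⊆H u u∈a⊤⊤)

  ⊤⊤-meet-least : IsStone → ∀ {a b m H} → IsMeet a b m → IsFilter H →
                  (a ⊤⊤) ⊆ H → (b ⊤⊤) ⊆ H → (m ⊤⊤) ⊆ H
  ⊤⊤-meet-least stone {a} {b} {m} {H} a∧b≡m H-filter a⊤⊤⊆H b⊤⊤⊆H y y∈m⊤⊤ =
    stone-∨-preimage-∈ stone a y H-filter
      (λ t t∈a⊤ → stone-∨-preimage-∈ stone b (t ∨ y) H-filter
        (λ s s∈b⊤ → subst H (sym (s∨t∨y≡𝟏 t s t∈a⊤ s∈b⊤)) (IsFilter.has-𝟏 H-filter))
        b⊤⊤⊆H)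
      a⊤⊤⊆H
    where
    s∨t∨y≡𝟏 : ∀ t s → (a ⊤) t → (b ⊤) s → s ∨ (t ∨ y) ≡ 𝟏
    s∨t∨y≡𝟏 t s t∨a≡𝟏 s∨b≡𝟏 =
      ≡𝟏-upward (∨-least (≤-trans (y≤x∨y t y) (y≤x∨y s (t ∨ y))) (∨-monotonic ≤-refl (x≤x∨y t y)))
        (y∈m⊤⊤ (s ∨ t) (⊤-meet a∧b≡m
          (≡𝟏-upward (∨-monotonic (y≤x∨y s t) ≤-refl) t∨a≡𝟏)
          (≡𝟏-upward (∨-monotonic (x≤x∨y s t) ≤-refl) s∨b≡𝟏)))

lemma4p4 : ∀ {c : Level} (𝐀 : DistributiveNearlattice c) →
    let open DistributiveNearlattice 𝐀 in
    IsStone → ∀ a b m → IsMeet a b m →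
    IsFilterJoin (a ⊤⊤) (b ⊤⊤) (m ⊤⊤)
lemma4p4 𝐀 stone a b m a∧b≡m@(_ , m≤a , m≤b , _) =
  ⊤⊤-isFilter m , ⊤⊤-antitone m≤a , ⊤⊤-antitone m≤b ,
  λ H H-filter → ⊤⊤-meet-least stone a∧b≡m H-filter
  where open DistributiveNearlatticeProperties 𝐀
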